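{- Let $(\alpha,\beta,\gamma)\in\mathbb{Z}[i]^3$ satisfy $\alpha^2+\beta^2+\gamma^2=0$, $\alpha\beta\gamma\neq 0$ and $\gcd(\alpha,\beta,\gamma)\in U$. Then $\alpha\beta\gamma\equiv 0 \pmod{(1+i)^2}$.
   Context: $\mathbb{Z}[i]$ is the ring of Gaussian integers and $U=\{1,-1,i,-i\}$ its unit group. Congruences modulo $\mu\in\mathbb{Z}[i]$ mean divisibility by $\mu$ in $\mathbb{Z}[i]$. "$\gcd(\alpha,\beta,\gamma)\in U$" means $\alpha,\beta,\gamma$ have no common non-unit divisor. -}

module Defs where

open import Data.Integer as ℤ using (ℤ; +_; -[1+_])
open import Data.Product using (∃; _,_)
open import Data.Sum using (_⊎_)
open import Relation.Binary.PropositionalEquality using (_≡_)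

record 𝔾 : Set where
  constructor _+_i
  field
    re : ℤ
    im : ℤ
open 𝔾 public

infixl 6 _⊕_
infixl 7 _⊗_

_⊕_ : 𝔾 → 𝔾 → 𝔾
(a + b i) ⊕ (c + d i) = (a ℤ.+ c) + (b ℤ.+ d) i

_⊗_ : 𝔾 → 𝔾 → 𝔾
(a + b i) ⊗ (c + d i) = (a ℤ.* c ℤ.- b ℤ.* d) + (a ℤ.* d ℤ.+ b ℤ.* c) i

𝟘 𝟙 ι : 𝔾
𝟘 = (+ 0) + (+ 0) i
𝟙 = (+ 1) + (+ 0) i
ι = (+ 0) + (+ 1) i

infix 4 _∣_
_∣_ : 𝔾 → 𝔾 → Set
μ ∣ α = ∃ λ κ → α ≡ κ ⊗ μ

infix 4 _≡_[mod_]
_≡_[mod_] : 𝔾 → 𝔾 → 𝔾 → Set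
α ≡ β [mod μ ] = μ ∣ (α ⊕ ((ℤ.- (+ 1)) + (+ 0) i) ⊗ β)

InU : 𝔾 → Set
InU δ = (δ ≡ (+ 1) + (+ 0) i) ⊎ (δ ≡ -[1+ 0 ] + (+ 0) i)
      ⊎ (δ ≡ (+ 0) + (+ 1) i) ⊎ (δ ≡ (+ 0) + -[1+ 0 ] i)

GcdInU : 𝔾 → 𝔾 → 𝔾 → Set
GcdInU α β γ = ∀ δ → δ ∣ α → δ ∣ β → δ ∣ γ → InU δ

{-# OPTIONS --safe #-}
-- Write α = a + b i, β = c + d i, γ = e + f i. The real part of α² + β² + γ² = 0
-- gives Σ (a² − b²) = 0, and half its imaginary part gives Σ ab = 0, so the sum of
-- a² − b² + ab over α, β, γ vanishes. Now a² − b² + ab is odd unless a and b are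
-- both even, so one of α, β, γ lies in 2 ℤ[i] = (1 + i)² ℤ[i], and with it αβγ.
module Submission where

open import Defs
open import Relation.Binary.PropositionalEquality using (_≡_)
open import Relation.Nullary using (¬_)

open import Data.Bool using (Bool; true; false; _∧_; _∨_; _xor_)
open import Data.Bool.Properties using (∨-conicalˡ; ∨-conicalʳ)
open import Data.Integer using (ℤ; +_; -[1+_]; _+_; _-_; _*_; -_)
open import Data.Integer.DivMod using (_%ℕ_; _/ℕ_; n%ℕd<d; a≡a%ℕn+[a/ℕn]*n)
open import Data.Integer.Properties using (+-comm; *-comm; +-identityʳ; *-cancelˡ-≡)
open import Data.Integer.Tactic.RingSolver using (solve-∀)
import Data.Nat as ℕ
open import Data.Empty using (⊥-elim)
open import Data.Product using (∃; _,_)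
open import Data.Sum using (_⊎_; inj₁; inj₂)
open import Relation.Binary.PropositionalEquality
  using (refl; sym; trans; cong; cong₂; subst; module ≡-Reasoning)

open ≡-Reasoning

bit : Bool → ℤ
bit false = + 0
bit true  = + 1

record Parity (b : Bool) (x : ℤ) : Set where
  constructor _,_
  field
    half : ℤ
    x≡2*half+b : x ≡ + 2 * half + bit b

<2⇒bit : ∀ r → r ℕ.< 2 → ∃ λ b → + r ≡ bit b
<2⇒bit 0 _ = false , refl
<2⇒bit 1 _ = true , refl
<2⇒bit (ℕ.suc (ℕ.suc _)) (ℕ.s≤s (ℕ.s≤s ()))

parity : ∀ x → ∃ λ b → Parity b x
parity x with <2⇒bit (x %ℕ 2) (n%ℕd<d x 2)
... | b , r≡b = b , x /ℕ 2 , (begin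
  x                          ≡⟨ a≡a%ℕn+[a/ℕn]*n x 2 ⟩
  + (x %ℕ 2) + x /ℕ 2 * + 2  ≡⟨ cong (_+ x /ℕ 2 * + 2) r≡b ⟩
  bit b + x /ℕ 2 * + 2       ≡⟨ +-comm (bit b) _ ⟩
  x /ℕ 2 * + 2 + bit b       ≡⟨ cong (_+ bit b) (*-comm (x /ℕ 2) (+ 2)) ⟩
  + 2 * (x /ℕ 2) + bit b     ∎)

bit-+ : ∀ b c → bit b + bit c ≡ bit (b xor c) + + 2 * bit (b ∧ c)
bit-+ false false = refl
bit-+ false true  = refl
bit-+ true  false = refl
bit-+ true  true  = refl

bit-* : ∀ b c → bit b * bit c ≡ bit (b ∧ c)
bit-* false false = refl
bit-* false true  = refl
bit-* true  false = refl
bit-* true  true  = refl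

Parity-+ : ∀ {b c x y} → Parity b x → Parity c y → Parity (b xor c) (x + y)
Parity-+ {b} {c} (k , refl) (l , refl) = k + l + bit (b ∧ c) , (begin
  (+ 2 * k + bit b) + (+ 2 * l + bit c)
    ≡⟨ regroup k l (bit b) (bit c) ⟩
  + 2 * (k + l) + (bit b + bit c)
    ≡⟨ cong (_+_ (+ 2 * (k + l))) (bit-+ b c) ⟩
  + 2 * (k + l) + (bit (b xor c) + + 2 * bit (b ∧ c))
    ≡⟨ carry k l (bit (b xor c)) (bit (b ∧ c)) ⟩
  + 2 * (k + l + bit (b ∧ c)) + bit (b xor c) ∎)
  where
  regroup : ∀ k l x y → (+ 2 * k + x) + (+ 2 * l + y) ≡ + 2 * (k + l) + (x + y)
  regroup = solve-∀
  carry : ∀ k l x y → + 2 * (k + l) + (x + + 2 * y) ≡ + 2 * (k + l + y) + x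
  carry = solve-∀

Parity-* : ∀ {b c x y} → Parity b x → Parity c y → Parity (b ∧ c) (x * y)
Parity-* {b} {c} (k , refl) (l , refl) = w , (begin
  (+ 2 * k + bit b) * (+ 2 * l + bit c)  ≡⟨ expand k l (bit b) (bit c) ⟩
  + 2 * w + bit b * bit c                ≡⟨ cong (_+_ (+ 2 * w)) (bit-* b c) ⟩
  + 2 * w + bit (b ∧ c)                  ∎)
  where
  w : ℤ
  w = + 2 * k * l + k * bit c + bit b * l
  expand : ∀ k l x y → (+ 2 * k + x) * (+ 2 * l + y)
    ≡ + 2 * (+ 2 * k * l + k * y + x * l) + x * y
  expand = solve-∀

Parity-neg : ∀ {b x} → Parity b x → Parity b (- x)
Parity-neg {b} (k , refl) = - k - bit b , negate k (bit b)
  where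
  negate : ∀ k x → - (+ 2 * k + x) ≡ + 2 * (- k - x) + x
  negate = solve-∀

1≢2* : ∀ m → ¬ (+ 1 ≡ + 2 * m)
1≢2* (+ 0) ()
1≢2* (+ 1) ()
1≢2* (+ ℕ.suc (ℕ.suc _)) ()
1≢2* -[1+ _ ] ()

odd≢even : ∀ {x} → Parity true x → ¬ Parity false x
odd≢even (k , refl) (l , odd≡even) = 1≢2* (l - k) (begin
  + 1                        ≡⟨ cancel k ⟩
  (+ 2 * k + + 1) - + 2 * k  ≡⟨ cong (_- + 2 * k) odd≡even ⟩
  (+ 2 * l + + 0) - + 2 * k  ≡⟨ factor k l ⟩
  + 2 * (l - k)              ∎)
  where
  cancel : ∀ k → + 1 ≡ (+ 2 * k + + 1) - + 2 * k
  cancel = solve-∀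
  factor : ∀ k l → (+ 2 * l + + 0) - + 2 * k ≡ + 2 * (l - k)
  factor = solve-∀

Parity-unique : ∀ {b c x} → Parity b x → Parity c x → b ≡ c
Parity-unique {false} {false} _    _    = refl
Parity-unique {true}  {true}  _    _    = refl
Parity-unique {true}  {false} odd  even = ⊥-elim (odd≢even odd even)
Parity-unique {false} {true}  even odd  = ⊥-elim (odd≢even odd even)

one-summand-even : ∀ {x y z} → x + y + z ≡ + 0 →
  Parity false x ⊎ Parity false y ⊎ Parity false z
one-summand-even {x} {y} {z} sum≡0 with parity x | parity y | parity z
... | false , even | _            | _            = inj₁ even
... | true  , _    | false , even | _            = inj₂ (inj₁ even)
... | true  , _    | true  , _    | false , even = inj₂ (inj₂ even)
... | true  , px   | true  , py   | true  , pz   =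
  ⊥-elim (odd≢even (subst (Parity true) sum≡0 (Parity-+ (Parity-+ px py) pz)) (+ 0 , refl))

⊗-comm : ∀ α β → α ⊗ β ≡ β ⊗ α
⊗-comm (a + b i) (c + d i) = cong₂ _+_i (re-comm a b c d) (im-comm a b c d)
  where
  re-comm : ∀ a b c d → a * c - b * d ≡ c * a - d * b
  re-comm = solve-∀
  im-comm : ∀ a b c d → a * d + b * c ≡ c * b + d * a
  im-comm = solve-∀

⊗-assoc : ∀ α β γ → α ⊗ β ⊗ γ ≡ α ⊗ (β ⊗ γ)
⊗-assoc (a + b i) (c + d i) (e + f i) = cong₂ _+_i (re-assoc a b c d e f) (im-assoc a b c d e f)
  where
  re-assoc : ∀ a b c d e f →
    (a * c - b * d) * e - (a * d + b * c) * f ≡ a * (c * e - d * f) - b * (c * f + d * e)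
  re-assoc = solve-∀
  im-assoc : ∀ a b c d e f →
    (a * c - b * d) * f + (a * d + b * c) * e ≡ a * (c * f + d * e) + b * (c * e - d * f)
  im-assoc = solve-∀

∣α⇒∣α⊗β : ∀ {μ α} β → μ ∣ α → μ ∣ α ⊗ β
∣α⇒∣α⊗β {μ} β (κ , refl) = κ ⊗ β , (begin
  κ ⊗ μ ⊗ β    ≡⟨ ⊗-assoc κ μ β ⟩
  κ ⊗ (μ ⊗ β)  ≡⟨ cong (κ ⊗_) (⊗-comm μ β) ⟩
  κ ⊗ (β ⊗ μ)  ≡⟨ sym (⊗-assoc κ β μ) ⟩
  κ ⊗ β ⊗ μ    ∎)

∣β⇒∣α⊗β : ∀ {μ β} α → μ ∣ β → μ ∣ α ⊗ β
∣β⇒∣α⊗β {μ} α (κ , refl) = α ⊗ κ , sym (⊗-assoc α κ μ)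

∣⇒≡𝟘[mod] : ∀ {μ α} → μ ∣ α → α ≡ 𝟘 [mod μ ]
∣⇒≡𝟘[mod] {μ} {a + b i} = subst (μ ∣_) (sym (cong₂ _+_i (+-identityʳ a) (+-identityʳ b)))

2∣⇒[1+i]²∣ : ∀ {a b} → Parity false a → Parity false b → (𝟙 ⊕ ι) ⊗ (𝟙 ⊕ ι) ∣ a + b i
2∣⇒[1+i]²∣ (k , refl) (l , refl) = l + (- k) i , cong₂ _+_i (re-eq k l) (im-eq k l)
  where
  re-eq : ∀ k l → + 2 * k + + 0 ≡ l * + 0 - (- k) * + 2
  re-eq = solve-∀
  im-eq : ∀ k l → + 2 * l + + 0 ≡ l * + 2 + (- k) * + 0
  im-eq = solve-∀

parityForm : 𝔾 → ℤ
parityForm α = re (α ⊗ α) + re α * im α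

parityForm-parity : ∀ {p q α} → Parity p (re α) → Parity q (im α) → Parity (p ∨ q) (parityForm α)
parityForm-parity {p} {q} {α} pa pb = subst (λ n → Parity n (parityForm α)) (bits p q) termwise
  where
  termwise : Parity ((p ∧ p xor q ∧ q) xor p ∧ q) (re α * re α - im α * im α + re α * im α)
  termwise = Parity-+ (Parity-+ (Parity-* pa pa) (Parity-neg (Parity-* pb pb))) (Parity-* pa pb)
  bits : ∀ p q → (p ∧ p xor q ∧ q) xor p ∧ q ≡ p ∨ q
  bits false false = refl
  bits false true  = refl
  bits true  false = refl
  bits true  true  = refl

parityForm-even⇒[1+i]²∣ : ∀ α → Parity false (parityForm α) → (𝟙 ⊕ ι) ⊗ (𝟙 ⊕ ι) ∣ α
parityForm-even⇒[1+i]²∣ (a + b i) even with parity a | parity b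
... | p , pa | q , pb with Parity-unique (parityForm-parity {α = a + b i} pa pb) even
... | p∨q≡false with ∨-conicalˡ p q p∨q≡false | ∨-conicalʳ p q p∨q≡false
... | refl | refl = 2∣⇒[1+i]²∣ pa pb

parityForm-sum : ∀ α β γ → α ⊗ α ⊕ β ⊗ β ⊕ γ ⊗ γ ≡ 𝟘 →
  parityForm α + parityForm β + parityForm γ ≡ + 0
parityForm-sum (a + b i) (c + d i) (e + f i) sum≡0 = begin
  parityForm (a + b i) + parityForm (c + d i) + parityForm (e + f i)
    ≡⟨ split a b c d e f ⟩
  (a * a - b * b + (c * c - d * d) + (e * e - f * f)) + (a * b + c * d + e * f)
    ≡⟨ cong₂ _+_ (cong re sum≡0) Σab≡0 ⟩
  + 0 ∎
  where
  split : ∀ a b c d e f →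
    (a * a - b * b + a * b) + (c * c - d * d + c * d) + (e * e - f * f + e * f)
      ≡ (a * a - b * b + (c * c - d * d) + (e * e - f * f)) + (a * b + c * d + e * f)
  split = solve-∀
  double : ∀ a b c d e f →
    + 2 * (a * b + c * d + e * f) ≡ a * b + b * a + (c * d + d * c) + (e * f + f * e)
  double = solve-∀
  Σab≡0 : a * b + c * d + e * f ≡ + 0
  Σab≡0 = *-cancelˡ-≡ (+ 2) _ (+ 0) (trans (double a b c d e f) (cong im sum≡0))

lemma4p1 : (α β γ : 𝔾) →
    α ⊗ α ⊕ β ⊗ β ⊕ γ ⊗ γ ≡ 𝟘 →
    ¬ (α ⊗ β ⊗ γ ≡ 𝟘) →
    GcdInU α β γ →
    α ⊗ β ⊗ γ ≡ 𝟘 [mod (𝟙 ⊕ ι) ⊗ (𝟙 ⊕ ι) ]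
lemma4p1 α β γ sum≡0 _ _ =
  ∣⇒≡𝟘[mod] (divides-product (one-summand-even (parityForm-sum α β γ sum≡0)))
  where
  divides-product :
    Parity false (parityForm α) ⊎ Parity false (parityForm β) ⊎ Parity false (parityForm γ) →
    (𝟙 ⊕ ι) ⊗ (𝟙 ⊕ ι) ∣ α ⊗ β ⊗ γ
  divides-product (inj₁ even)        = ∣α⇒∣α⊗β γ (∣α⇒∣α⊗β β (parityForm-even⇒[1+i]²∣ α even))
  divides-product (inj₂ (inj₁ even)) = ∣α⇒∣α⊗β γ (∣β⇒∣α⊗β α (parityForm-even⇒[1+i]²∣ β even))
  divides-product (inj₂ (inj₂ even)) = ∣β⇒∣α⊗β (α ⊗ β) (parityForm-even⇒[1+i]²∣ γ even)
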